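{- Let $n\geq 3$ be odd, $m\geq 2$, and let $\Gamma$ be an Abelian group of order $(2m-1)n$ having a cyclic subgroup of order $2m-1$. Then the generalized open web $OW_{m,n}$ admits a $\Gamma$-harmonious labeling.
   Context: The generalized prism $Y_{m,n}$ is the Cartesian product $P_m\Box C_n$ (layers $C^1,\dots,C^m$ of $C_n$ with corresponding vertices of consecutive layers adjacent). The generalized closed web $CW_{m,n}$ is obtained from $Y_{m,n}$ by adding one new vertex joined to every vertex of the top cycle $C^1$; the generalized open web $OW_{m,n}$ is obtained from $CW_{m,n}$ by deleting the edges of the bottom cycle $C^m$, and has $(2m-1)n$ edges. For a graph $G=(V,E)$ with $q$ edges and a finite Abelian group $\Gamma$ of order $q$, a $\Gamma$-harmonious labeling is an injection $f:V\to\Gamma$ such that the induced edge labeling $w(xy)=f(x)+f(y)$ is a bijection from $E$ to $\Gamma$. -}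

module Defs where

open import Level using (Level; _⊔_)
open import Data.Nat using (ℕ; zero; suc; NonZero)
open import Data.Nat.DivMod using (_mod_)
open import Data.Fin using (Fin; toℕ; inject₁)
import Data.Fin as F
open import Data.Product using (Σ; ∃; _×_; _,_)
open import Relation.Binary.PropositionalEquality using (_≡_)
open import Relation.Nullary using (¬_)
open import Algebra.Bundles using (AbelianGroup)

-- Vertices: the hub (the extra vertex) and layer vertices  v i j,
-- i : Fin m (layer C^{i+1}; layer zero is the top cycle C^1),
-- j : Fin n (position on the cycle C_n).

data OWVertex (m n : ℕ) : Set where
  hub : OWVertex m n
  v   : Fin m → Fin n → OWVertex m n

next : {n : ℕ} → Fin n → Fin n
next {suc n} j = (suc (toℕ j)) mod (suc n)

-- Edges of OW_{m,n}; there are m layers, written m = suc k: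
--   spoke j  : hub — v 0 j                      (n edges)
--   cyc i j  : v i j — v i (j+1), i < k = m-1    ((m-1)n edges; bottom cycle deleted)
--   rung i j : v i j — v (i+1) j, i < m-1        ((m-1)n edges)
-- total (2m-1)n edges.
data OWEdge : ℕ → ℕ → Set where
  spoke : ∀ {k n} → Fin n → OWEdge (suc k) n
  cyc   : ∀ {k n} → Fin k → Fin n → OWEdge (suc k) n
  rung  : ∀ {k n} → Fin k → Fin n → OWEdge (suc k) n

ends : ∀ {m n} → OWEdge m n → OWVertex m n × OWVertex m n
ends (spoke j)  = hub , v F.zero j
ends (cyc i j)  = v (inject₁ i) j , v (inject₁ i) (next j)
ends (rung i j) = v (inject₁ i) j , v (F.suc i) j

module _ {c ℓ : Level} (G : AbelianGroup c ℓ) where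
  open AbelianGroup G

  _·_ : ℕ → Carrier → Carrier
  zero  · g = ε
  suc k · g = g ∙ (k · g)

  HasOrder : ℕ → Set (c ⊔ ℓ)
  HasOrder q = Σ (Fin q → Carrier) λ e →
                 (∀ a b → e a ≈ e b → a ≡ b) × (∀ g → ∃ λ a → e a ≈ g)

  ElementOrder : Carrier → ℕ → Set ℓ
  ElementOrder g d = NonZero d × (d · g ≈ ε) ×
                     (∀ k → 0 Data.Nat.< k → k Data.Nat.< d → ¬ (k · g ≈ ε))

  -- Γ has a cyclic subgroup of order d, i.e. an element of order d
  -- (the subgroup it generates).
  HasCyclicSubgroupOfOrder : ℕ → Set (c ⊔ ℓ)
  HasCyclicSubgroupOfOrder d = ∃ λ g → ElementOrder g d

  edgeLabel : ∀ {m n} → (OWVertex m n → Carrier) → OWEdge m n → Carrier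
  edgeLabel f e with ends e
  ... | x , y = f x ∙ f y

  IsHarmoniousOW : (m n : ℕ) → (OWVertex m n → Carrier) → Set (c ⊔ ℓ)
  IsHarmoniousOW m n f =
      (∀ x y → f x ≈ f y → x ≡ y)
    × (∀ e e′ → edgeLabel f e ≈ edgeLabel f e′ → e ≡ e′)
    × (∀ g → ∃ λ e → edgeLabel f e ≈ g)

{-# OPTIONS --safe #-}
module Submission where

-- Write d = 2m - 1 = 2k + 1, so N = |Γ| = d n is odd. The character
-- g ↦ N / d of ⟨g⟩ extends to a character of Γ into ℤ/N (ℤ/N is injective
-- for groups of exponent dividing N), and from its image one obtains a
-- subgroup K of order n such that Γ / K is cyclic of order d, generated by
-- some u: every element is uniquely j · u + s with j < d and s ∈ K. Being of
-- odd order, K has a harmonious ordering b₀, …, b_(n-1), i.e. the cyclically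
-- consecutive sums b_p + b_(p+1) are distinct too; it is built digit by
-- digit along a chain of cyclic extensions. Label the hub 2k · u and vertex p
-- of layer i by i · u + b_p. Spokes, cycle edges of layer i and rungs below
-- layer i then get 2k · u + b_p, 2i · u + (b_p + b_(p+1)) and
-- (2i + 1) · u + 2 b_p: the u-digits 2k, 2i, 2i + 1 run through 0, …, 2k
-- exactly once, and for each of them the K-parts run through all of K.

open import Defs hiding (_·_)
import Defs
open import Level using (Level; 0ℓ)
open import Algebra.Bundles using (AbelianGroup)
open import Algebra.Core using (Op₁; Op₂)
open import Algebra.Structures using (IsAbelianGroup)
open import Data.Empty using (⊥-elim)
open import Data.Fin as Fin using (Fin; toℕ; fromℕ<; inject₁)
import Data.Fin.Properties as Finₚ
open import Data.Fin.Permutation using (Permutation; permutation)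
open import Data.List using (List; []; _∷_; allFin)
open import Data.List.Membership.Propositional using () renaming (_∈_ to _∈ₗ_)
open import Data.List.Membership.Propositional.Properties using (∈-allFin)
open import Data.List.Relation.Unary.Any using (here; there)
open import Data.Nat
open import Data.Nat.Properties
open import Data.Nat.DivMod
open import Data.Nat.Divisibility
open import Data.Nat.Primality using (euclidsLemma; prime[2])
open import Data.Nat.Solver using (module +-*-Solver)
open import Data.Product using (∃; _×_; _,_; proj₁; proj₂; uncurry)
open import Data.Sum using (_⊎_; inj₁; inj₂; [_,_]′)
open import Data.Unit using (⊤; tt)
open import Data.Vec.Functional using (replicate)
open import Function using (id; _∘_)
open import Relation.Nullary using (¬_; yes; no; contradiction)
open import Relation.Nullary.Decidable using (_×-dec_)
open import Relation.Unary using (Pred; Decidable)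
open import Relation.Binary.PropositionalEquality

open +-*-Solver using (solve; _:+_; _:*_; _:=_)

Least : (ℕ → Set) → ℕ → Set
Least Q k = Q k × (∀ {j} → j < k → ¬ Q j)

module _ {Q : ℕ → Set} (Q? : Decidable Q) where

  private
    searchBelow : ∀ b → (∀ {j} → j < b → ¬ Q j) ⊎ ∃ (Least Q)
    searchBelow zero = inj₁ λ ()
    searchBelow (suc b) with searchBelow b
    ... | inj₂ found = inj₂ found
    ... | inj₁ none with Q? b
    ...   | yes q = inj₂ (b , q , none)
    ...   | no ¬q = inj₁ λ j<1+b → extend (m≤n⇒m<n∨m≡n (s≤s⁻¹ j<1+b))
      where
      extend : ∀ {j} → j < b ⊎ j ≡ b → ¬ Q j
      extend (inj₁ j<b)  = none j<b
      extend (inj₂ refl) = ¬q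

  least : ∀ {b} → Q b → ∃ (Least Q)
  least {b} q with searchBelow (suc b)
  ... | inj₁ none = contradiction q (none ≤-refl)
  ... | inj₂ found = found

n<m∧m∣n⇒n≡0 : ∀ {m n} → n < m → m ∣ n → n ≡ 0
n<m∧m∣n⇒n≡0 {m} {zero}  _   _   = refl
n<m∧m∣n⇒n≡0 {m} {suc n} n<m m∣n = contradiction (∣⇒≤ m∣n) (<⇒≱ n<m)

addDigits : ∀ {k i j} → i < k → j < k → ∃ λ l → l < k × (i + j ≡ l ⊎ i + j ≡ k + l)
addDigits {k} {i} {j} i<k j<k with i + j <? k
... | yes i+j<k = i + j , i+j<k , inj₁ refl
... | no  i+j≮k = i + j ∸ k , m<n+o⇒m∸n<o (i + j) k {{>-nonZero (≤-<-trans z≤n i<k)}} (+-mono-< i<k j<k)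
                            , inj₂ (sym (m+[n∸m]≡n (≮⇒≥ i+j≮k)))

evenOrOdd : ∀ j → ∃ λ i → j ≡ 2 * i ⊎ j ≡ suc (2 * i)
evenOrOdd zero = 0 , inj₁ refl
evenOrOdd (suc j) with evenOrOdd j
... | i , inj₁ refl = i , inj₂ refl
... | i , inj₂ refl = suc i , inj₁ (cong suc (sym (+-suc i (i + 0))))

¬2∣⇒odd : ∀ {n} → ¬ 2 ∣ n → ∃ λ h → n ≡ suc (2 * h)
¬2∣⇒odd {n} ¬2∣n with evenOrOdd n
... | h , inj₁ n≡2h = contradiction (divides h (trans n≡2h (*-comm 2 h))) ¬2∣n
... | h , inj₂ n≡1+2h = h , n≡1+2h

¬2∣1+2* : ∀ k → ¬ 2 ∣ suc (2 * k)
¬2∣1+2* k (divides q 1+2k≡q*2) = even≢odd q k (sym (trans 1+2k≡q*2 (*-comm q 2)))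

¬2∣* : ∀ {a b} → ¬ 2 ∣ a → ¬ 2 ∣ b → ¬ 2 ∣ a * b
¬2∣* {a} {b} ¬2∣a ¬2∣b 2∣ab = [ ¬2∣a , ¬2∣b ]′ (euclidsLemma a b prime[2] 2∣ab)

injective⇒surjective : ∀ {n} {f : Fin n → Fin n} → (∀ {a b} → f a ≡ f b → a ≡ b) →
                       ∀ y → ∃ λ x → f x ≡ y
injective⇒surjective {suc n} {f} f-inj y with Finₚ.any? (λ x → f x Finₚ.≟ y)
... | yes hit  = hit
... | no  miss = ⊥-elim (<-irrefl refl (Finₚ.injective⇒≤ punched-injective))
  where
  punched : Fin (suc n) → Fin n
  punched x = Fin.punchOut {i = y} (λ y≡fx → miss (x , sym y≡fx))
  punched-injective : ∀ {a b} → punched a ≡ punched b → a ≡ b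
  punched-injective = f-inj ∘ Finₚ.punchOut-injective {i = y} _ _

module _ {a b N : ℕ} (f : ℕ → ℕ → Fin N) where

  product-count : (∀ {i j i′ j′} → i < a → j < b → i′ < a → j′ < b → f i j ≡ f i′ j′ → i ≡ i′ × j ≡ j′) →
                  (∀ z → ∃ λ i → ∃ λ j → i < a × j < b × f i j ≡ z) → a * b ≡ N
  product-count f-unique f-onto = Finₚ.cantor-schröder-bernstein Φ-injective Ψ-injective
    where
    combine : Fin a → Fin b → Fin (a * b)
    combine = Fin.combine
    remQuot : Fin (a * b) → Fin a × Fin b
    remQuot = Fin.remQuot b
    Φ : Fin (a * b) → Fin N
    Φ x = uncurry (λ i j → f (toℕ i) (toℕ j)) (remQuot x)
    Φ-injective : ∀ {x y} → Φ x ≡ Φ y → x ≡ y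
    Φ-injective {x} {y} Φx≡Φy with f-unique (Finₚ.toℕ<n _) (Finₚ.toℕ<n _) (Finₚ.toℕ<n _) (Finₚ.toℕ<n _) Φx≡Φy
    ... | i≡i′ , j≡j′ = begin
      x                          ≡⟨ Finₚ.combine-remQuot {a} b x ⟨
      uncurry combine (remQuot x) ≡⟨ cong (uncurry combine) (cong₂ _,_ (Finₚ.toℕ-injective i≡i′) (Finₚ.toℕ-injective j≡j′)) ⟩
      uncurry combine (remQuot y) ≡⟨ Finₚ.combine-remQuot {a} b y ⟩
      y                          ∎
      where open ≡-Reasoning
    Ψ : Fin N → Fin (a * b)
    Ψ z = let i , j , i<a , j<b , _ = f-onto z in combine (fromℕ< i<a) (fromℕ< j<b)
    ΦΨ : ∀ z → Φ (Ψ z) ≡ z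
    ΦΨ z = let i , j , i<a , j<b , fij≡z = f-onto z in
      trans (cong (uncurry (λ i j → f (toℕ i) (toℕ j))) (Finₚ.remQuot-combine (fromℕ< i<a) (fromℕ< j<b)))
            (trans (cong₂ f (Finₚ.toℕ-fromℕ< i<a) (Finₚ.toℕ-fromℕ< j<b)) fij≡z)
    Ψ-injective : ∀ {z z′} → Ψ z ≡ Ψ z′ → z ≡ z′
    Ψ-injective {z} {z′} Ψz≡Ψz′ = trans (sym (ΦΨ z)) (trans (cong Φ Ψz≡Ψz′) (ΦΨ z′))

module Congruence (N : ℕ) .{{_ : NonZero N}} where

  infix 4 _≋_

  _≋_ : ℕ → ℕ → Set
  a ≋ b = a % N ≡ b % N

  ≋-+ : ∀ {a a′ b b′} → a ≋ a′ → b ≋ b′ → a + b ≋ a′ + b′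
  ≋-+ {a} {a′} {b} {b′} a≋a′ b≋b′ = begin
    (a + b) % N              ≡⟨ %-distribˡ-+ a b N ⟩
    (a % N + b % N) % N      ≡⟨ cong₂ (λ u w → (u + w) % N) a≋a′ b≋b′ ⟩
    (a′ % N + b′ % N) % N    ≡⟨ %-distribˡ-+ a′ b′ N ⟨
    (a′ + b′) % N            ∎
    where open ≡-Reasoning

  ≋-*ˡ : ∀ c {a b} → a ≋ b → c * a ≋ c * b
  ≋-*ˡ c {a} {b} a≋b = begin
    (c * a) % N              ≡⟨ %-distribˡ-* c a N ⟩
    (c % N * (a % N)) % N    ≡⟨ cong (λ u → (c % N * u) % N) a≋b ⟩
    (c % N * (b % N)) % N    ≡⟨ %-distribˡ-* c b N ⟨
    (c * b) % N              ∎
    where open ≡-Reasoning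

  %-≋ : ∀ a → a % N ≋ a
  %-≋ a = m%n%n≡m%n a N

  ≋-cancelʳ : ∀ m {a b} → a + m ≋ b + m → a ≋ b
  ≋-cancelʳ m {a} {b} a+m≋b+m = begin
    a % N                    ≡⟨ cancel a ⟨
    (a + m + m⁻) % N         ≡⟨ ≋-+ {a + m} {b + m} a+m≋b+m refl ⟩
    (b + m + m⁻) % N         ≡⟨ cancel b ⟩
    b % N                    ∎
    where
    open ≡-Reasoning
    m⁻ = N ∸ m % N
    m+m⁻≋0 : m + m⁻ ≋ 0
    m+m⁻≋0 = begin
      (m + m⁻) % N           ≡⟨ ≋-+ {m} {m % N} {m⁻} (sym (%-≋ m)) refl ⟩
      (m % N + m⁻) % N       ≡⟨ cong (_% N) (m+[n∸m]≡n (<⇒≤ (m%n<n m N))) ⟩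
      N % N                  ≡⟨ n%n≡0 N ⟩
      0                      ≡⟨ m<n⇒m%n≡m (>-nonZero⁻¹ N) ⟨
      0 % N                  ∎
    cancel : ∀ a → a + m + m⁻ ≋ a
    cancel a = trans (cong (_% N) (+-assoc a m m⁻))
                     (trans (≋-+ {a} {a} {m + m⁻} {0} refl m+m⁻≋0) (cong (_% N) (+-identityʳ a)))

  ∣-resp-≋ : ∀ {m a b} → m ∣ N → a ≋ b → m ∣ a → m ∣ b
  ∣-resp-≋ {m} m∣N a≋b m∣a = ∣n∣m%n⇒∣m m∣N (subst (m ∣_) a≋b (%-presˡ-∣ m∣a m∣N))


module FiniteAbelianGroup
  {N : ℕ} {op : Op₂ (Fin N)} {e : Fin N} {inv : Op₁ (Fin N)}
  (isAbelianGroup : IsAbelianGroup _≡_ op e inv) where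

  abelianGroup : AbelianGroup 0ℓ 0ℓ
  abelianGroup = record { isAbelianGroup = isAbelianGroup }

  open AbelianGroup abelianGroup public
    using (_∙_; ε; _⁻¹; assoc; comm; identityˡ; identityʳ; inverseˡ; inverseʳ; _-_)
  open AbelianGroup abelianGroup using (commutativeMonoid; commutativeSemigroup)
  open import Algebra.Properties.AbelianGroup abelianGroup public
    using (∙-cancelˡ; inverseʳ-unique; ε⁻¹≈ε; ⁻¹-∙-comm; ⁻¹-anti-homo‿-;
           //-rightDividesˡ; //-rightDividesʳ; x∙y⁻¹≈ε⇒x≈y)
  open import Algebra.Properties.CommutativeSemigroup commutativeSemigroup public
    using (interchange; x∙yz≈y∙xz)
  open import Algebra.Properties.CommutativeMonoid.Mult commutativeMonoid public
    using (×-homo-+; ×-homo-1; ×-assocˡ; ×-distrib-+)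
    renaming (_×_ to _·_)
  open import Algebra.Properties.CommutativeMonoid.Sum commutativeMonoid
    using (sum; sum-permute; ∑-distrib-+; sum-replicate)

  A : Set
  A = Fin N

  -‿interchange : ∀ a b c d → (a ∙ b) - (c ∙ d) ≡ (a - c) ∙ (b - d)
  -‿interchange a b c d = begin
    (a ∙ b) ∙ (c ∙ d) ⁻¹     ≡⟨ cong ((a ∙ b) ∙_) (sym (⁻¹-∙-comm c d)) ⟩
    (a ∙ b) ∙ (c ⁻¹ ∙ d ⁻¹)  ≡⟨ interchange a b (c ⁻¹) (d ⁻¹) ⟩
    (a - c) ∙ (b - d)        ∎
    where open ≡-Reasoning

  a-ε≡a : ∀ a → a - ε ≡ a
  a-ε≡a a = trans (cong (a ∙_) ε⁻¹≈ε) (identityʳ a)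

  -‿telescope : ∀ a b c → (a - b) ∙ (b - c) ≡ a - c
  -‿telescope a b c = trans (sym (assoc (a - b) b (c ⁻¹))) (cong (_- c) (//-rightDividesˡ b a))

  ·-∸ : ∀ a {i j} → j ≤ i → i · a - j · a ≡ (i ∸ j) · a
  ·-∸ a {i} {j} j≤i = begin
    i · a - j · a               ≡⟨ cong (λ l → l · a - j · a) (sym (m∸n+n≡m j≤i)) ⟩
    (i ∸ j + j) · a - j · a     ≡⟨ cong (_- j · a) (×-homo-+ a (i ∸ j) j) ⟩
    (i ∸ j) · a ∙ j · a - j · a ≡⟨ //-rightDividesʳ (j · a) _ ⟩
    (i ∸ j) · a                 ∎
    where open ≡-Reasoning

  -- Translation by a permutes the group, so the sum of all elements
  -- absorbs N copies of a.
  N·a≡ε : ∀ a → N · a ≡ ε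
  N·a≡ε a = ∙-cancelˡ total (N · a) ε (begin
    total ∙ N · a                ≡⟨ cong (total ∙_) (sym (sum-replicate N)) ⟩
    total ∙ sum (replicate N a)  ≡⟨ sym (∑-distrib-+ id (replicate N a)) ⟩
    sum (λ z → z ∙ a)            ≡⟨ sym (sum-permute id translation) ⟩
    total                        ≡⟨ sym (identityʳ total) ⟩
    total ∙ ε                    ∎)
    where
    open ≡-Reasoning
    total = sum id
    translation : Permutation N N
    translation = permutation (_∙ a) (_- a) (//-rightDividesˡ a) (//-rightDividesʳ a)

  ⁻¹≡[N∸1]· : ∀ a → a ⁻¹ ≡ (N ∸ 1) · a
  ⁻¹≡[N∸1]· a = sym (inverseʳ-unique a ((N ∸ 1) · a) (begin
    a ∙ (N ∸ 1) · a   ≡⟨ cong (_· a) (suc-pred N {{Finₚ.nonZeroIndex a}}) ⟩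
    N · a             ≡⟨ N·a≡ε a ⟩
    ε                 ∎))
    where open ≡-Reasoning

  record Subgroup : Set₁ where
    field
      Member  : Pred A 0ℓ
      member? : Decidable Member
      ε∈      : Member ε
      ∙∈      : ∀ {a b} → Member a → Member b → Member (a ∙ b)

  open Subgroup public

  infix 4 _∈_ _∼[_]_

  _∈_ : A → Subgroup → Set
  a ∈ S = Member S a

  _∼[_]_ : A → Subgroup → A → Set
  a ∼[ S ] b = a - b ∈ S

  _⊆_ : Subgroup → Subgroup → Set
  S ⊆ T = ∀ {a} → a ∈ S → a ∈ T

  trivial : Subgroup
  trivial = record
    { Member = _≡ ε ; member? = λ a → a Finₚ.≟ ε ; ε∈ = refl
    ; ∙∈ = λ { refl refl → identityˡ ε } }

  ∼trivial⇒≡ : ∀ {a b} → a ∼[ trivial ] b → a ≡ b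
  ∼trivial⇒≡ = x∙y⁻¹≈ε⇒x≈y _ _

  whole : Subgroup
  whole = record { Member = λ _ → ⊤ ; member? = λ _ → yes tt ; ε∈ = tt ; ∙∈ = λ _ _ → tt }

  module _ (S : Subgroup) where

    ·∈ : ∀ j {a} → a ∈ S → j · a ∈ S
    ·∈ zero    _   = ε∈ S
    ·∈ (suc j) a∈S = ∙∈ S a∈S (·∈ j a∈S)

    ⁻¹∈ : ∀ {a} → a ∈ S → a ⁻¹ ∈ S
    ⁻¹∈ {a} a∈S = subst (_∈ S) (sym (⁻¹≡[N∸1]· a)) (·∈ (N ∸ 1) a∈S)

    ∈⇒∼ε : ∀ {a} → a ∈ S → a ∼[ S ] ε
    ∈⇒∼ε {a} = subst (_∈ S) (sym (a-ε≡a a))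

    ∼ε⇒∈ : ∀ {a} → a ∼[ S ] ε → a ∈ S
    ∼ε⇒∈ {a} = subst (_∈ S) (a-ε≡a a)

    ∼-refl : ∀ {a} → a ∼[ S ] a
    ∼-refl {a} = subst (_∈ S) (sym (inverseʳ a)) (ε∈ S)

    ≡⇒∼ : ∀ {a b} → a ≡ b → a ∼[ S ] b
    ≡⇒∼ refl = ∼-refl

    ∼-sym : ∀ {a b} → a ∼[ S ] b → b ∼[ S ] a
    ∼-sym {a} {b} a∼b = subst (_∈ S) (⁻¹-anti-homo‿- a b) (⁻¹∈ a∼b)

    ∼-trans : ∀ {a b c} → a ∼[ S ] b → b ∼[ S ] c → a ∼[ S ] c
    ∼-trans {a} {b} {c} a∼b b∼c = subst (_∈ S) (-‿telescope a b c) (∙∈ S a∼b b∼c)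

    ∼-∙ : ∀ {a a′ b b′} → a ∼[ S ] a′ → b ∼[ S ] b′ → a ∙ b ∼[ S ] a′ ∙ b′
    ∼-∙ {a} {a′} {b} {b′} a∼a′ b∼b′ =
      subst (_∈ S) (sym (-‿interchange a b a′ b′)) (∙∈ S a∼a′ b∼b′)

    ∼-cancelˡ : ∀ {a b c} → a ∙ b ∼[ S ] a ∙ c → b ∼[ S ] c
    ∼-cancelˡ {a} {b} {c} ab∼ac = subst (_∈ S) difference ab∼ac
      where
      difference : (a ∙ b) - (a ∙ c) ≡ b - c
      difference = trans (-‿interchange a b a c)
                         (trans (cong (_∙ (b - c)) (inverseʳ a)) (identityˡ (b - c)))

    ∙-absorbs : ∀ {a s} → s ∈ S → a ∙ s ∼[ S ] a
    ∙-absorbs {a} {s} s∈S = subst (_∈ S) (sym (trans (cong (_- a) (comm a s)) (//-rightDividesʳ a s))) s∈S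

  record RelativeOrder (S : Subgroup) (x : A) (k : ℕ) : Set where
    field
      positive : 0 < k
      k·x∈S    : k · x ∈ S
      minimal  : ∀ {j} → 0 < j → j < k → ¬ j · x ∈ S

  relativeOrder : ∀ S x → ∃ (RelativeOrder S x)
  relativeOrder S x with least (λ j → (0 <? j) ×-dec member? S (j · x)) {N}
                               (≤-<-trans z≤n (Finₚ.toℕ<n x) , subst (_∈ S) (sym (N·a≡ε x)) (ε∈ S))
  ... | k , (k>0 , k·x∈S) , below = k , record
    { positive = k>0 ; k·x∈S = k·x∈S ; minimal = λ j>0 j<k j·x∈S → below j<k (j>0 , j·x∈S) }

  module RelativeOrderProperties {S x k} (o : RelativeOrder S x k) where
    open RelativeOrder o

    instance
      k≢0 : NonZero k
      k≢0 = >-nonZero positive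

    %-digit : ∀ i → i · x ∼[ S ] (i % k) · x
    %-digit i = subst (_∈ S) (sym difference) (·∈ S (i / k) k·x∈S)
      where
      difference : i · x - (i % k) · x ≡ (i / k) · k · x
      difference = begin
        i · x - (i % k) · x  ≡⟨ ·-∸ x (m%n≤m i k) ⟩
        (i ∸ i % k) · x      ≡⟨ cong (λ l → (l ∸ i % k) · x) (m≡m%n+[m/n]*n i k) ⟩
        (i % k + i / k * k ∸ i % k) · x ≡⟨ cong (_· x) (m+n∸m≡n (i % k) (i / k * k)) ⟩
        (i / k * k) · x      ≡⟨ ×-assocˡ x (i / k) k ⟨
        (i / k) · k · x      ∎
        where open ≡-Reasoning

    ·∈⇒∣ : ∀ {i} → i · x ∈ S → k ∣ i
    ·∈⇒∣ {i} i·x∈S with i % k in i%k≡r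
    ... | zero  = m%n≡0⇒n∣m i k i%k≡r
    ... | suc r = ⊥-elim (minimal z<s (subst (_< k) i%k≡r (m%n<n i k))
                                  (subst (λ l → l · x ∈ S) i%k≡r remainder∈S))
      where
      remainder∈S : (i % k) · x ∈ S
      remainder∈S = ∼ε⇒∈ S (∼-trans S (∼-sym S (%-digit i)) (∈⇒∼ε S i·x∈S))

    ∣N : k ∣ N
    ∣N = ·∈⇒∣ (subst (_∈ S) (sym (N·a≡ε x)) (ε∈ S))

    private
      ·-injective-≤ : ∀ {i j} → j ≤ i → i < k → i · x ∼[ S ] j · x → i ≡ j
      ·-injective-≤ {i} {j} j≤i i<k i∼j = ≤-antisym (m∸n≡0⇒m≤n i∸j≡0) j≤i
        where
        i∸j≡0 : i ∸ j ≡ 0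
        i∸j≡0 = n<m∧m∣n⇒n≡0 (≤-<-trans (m∸n≤m i j) i<k) (·∈⇒∣ (subst (_∈ S) (·-∸ x j≤i) i∼j))

    ·-injective : ∀ {i j} → i < k → j < k → i · x ∼[ S ] j · x → i ≡ j
    ·-injective {i} {j} i<k j<k i∼j with ≤-total j i
    ... | inj₁ j≤i = ·-injective-≤ j≤i i<k i∼j
    ... | inj₂ i≤j = sym (·-injective-≤ i≤j j<k (∼-sym S i∼j))

    carry : ∀ {m l} → m ≡ l ⊎ m ≡ k + l → m · x ∼[ S ] l · x
    carry (inj₁ refl) = ∼-refl S
    carry {l = l} (inj₂ refl) = subst (_∈ S) (sym k+l-l) k·x∈S
      where
      k+l-l : (k + l) · x - l · x ≡ k · x
      k+l-l = trans (·-∸ x (m≤n+m l k)) (cong (_· x) (m+n∸n≡m k l))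

    ∙-digits : ∀ {a b i j l} → a ∼[ S ] i · x → b ∼[ S ] j · x →
               i + j ≡ l ⊎ i + j ≡ k + l → a ∙ b ∼[ S ] l · x
    ∙-digits {i = i} {j} a∼i·x b∼j·x i+j≡l = ∼-trans S (∼-∙ S a∼i·x b∼j·x)
      (subst (_∼[ S ] _) (×-homo-+ x i j) (carry i+j≡l))

  adjoin : ∀ {S x k} → RelativeOrder S x k → Subgroup
  adjoin {S} {x} {k} o = record
    { Member  = λ z → ∃ λ j → j < k × z ∼[ S ] j · x
    ; member? = λ z → anyUpTo? (λ j → member? S (z - j · x)) k
    ; ε∈      = 0 , positive , ∼-refl S
    ; ∙∈      = ∙∈′
    }
    where
    open RelativeOrder o
    open RelativeOrderProperties o
    ∙∈′ : ∀ {a b} → ∃ (λ i → i < k × a ∼[ S ] i · x) → ∃ (λ j → j < k × b ∼[ S ] j · x) →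
          ∃ λ l → l < k × a ∙ b ∼[ S ] l · x
    ∙∈′ (i , i<k , a∼i·x) (j , j<k , b∼j·x) =
      let l , l<k , i+j≡l = addDigits i<k j<k in l , l<k , ∙-digits {i = i} {j} a∼i·x b∼j·x i+j≡l

  module AdjoinProperties {S x k} (o : RelativeOrder S x k) where
    open RelativeOrder o

    ⊆-adjoin : S ⊆ adjoin o
    ⊆-adjoin a∈S = 0 , positive , ∈⇒∼ε S a∈S

    x∈adjoin : x ∈ adjoin o
    x∈adjoin with member? S x
    ... | yes x∈S = ⊆-adjoin x∈S
    ... | no  x∉S = 1 , ≤∧≢⇒< positive k≢1 , ≡⇒∼ S (sym (×-homo-1 x))
      where
      k≢1 : 1 ≢ k
      k≢1 refl = x∉S (subst (_∈ S) (×-homo-1 x) k·x∈S)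

  data Chain (T : Subgroup) : Subgroup → Set₁ where
    done : ∀ {S} → T ⊆ S → Chain T S
    step : ∀ {S x k} (o : RelativeOrder S x k) → x ∈ T → Chain T (adjoin o) → Chain T S

  module _ (T : Subgroup) where

    private
      Covers : Subgroup → List A → Set
      Covers S l = ∀ {z} → z ∈ T → z ∈ S ⊎ z ∈ₗ l

      shrink : ∀ {S S′ a l} → S ⊆ S′ → (a ∈ T → a ∈ S′) → Covers S (a ∷ l) → Covers S′ l
      shrink S⊆S′ a∈S′ covers z∈T with covers z∈T
      ... | inj₁ z∈S         = inj₁ (S⊆S′ z∈S)
      ... | inj₂ (here refl) = inj₁ (a∈S′ z∈T)
      ... | inj₂ (there z∈l) = inj₂ z∈l

      chainFrom : ∀ {S} l → Covers S l → Chain T S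
      chainFrom {S} [] covers = done λ z∈T → [ id , (λ ()) ]′ (covers z∈T)
      chainFrom {S} (a ∷ l) covers with member? S a | member? T a
      ... | yes a∈S | _       = chainFrom l (shrink {S} {S} {a} id (λ _ → a∈S) covers)
      ... | no  _   | no a∉T  = chainFrom l (shrink {S} {S} {a} id (λ a∈T → contradiction a∈T a∉T) covers)
      ... | no  _   | yes a∈T = step o a∈T (chainFrom l (shrink {S} {adjoin o} {a} ⊆-adjoin (λ _ → x∈adjoin) covers))
        where
        o = proj₂ (relativeOrder S a)
        open AdjoinProperties o

    chain : ∀ S → Chain T S
    chain S = chainFrom (allFin N) (λ {z} _ → inj₂ (∈-allFin z))

  instance
    N≢0 : NonZero N
    N≢0 = Finₚ.nonZeroIndex ε

  open Congruence N public

  -- Characters into ℤ/N, with values in ℕ compared modulo N; only their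
  -- restriction to S needs to be a homomorphism.
  record Character (S : Subgroup) : Set where
    field
      χ   : A → ℕ
      χ-ε : χ ε ≋ 0
      χ-∙ : ∀ {a b} → a ∈ S → b ∈ S → χ (a ∙ b) ≋ χ a + χ b

    χ-· : ∀ i {a} → a ∈ S → χ (i · a) ≋ i * χ a
    χ-· zero    a∈S = χ-ε
    χ-· (suc i) {a} a∈S = trans (χ-∙ a∈S (·∈ S i a∈S)) (≋-+ {χ a} refl (χ-· i a∈S))

  open Character public

  trivialCharacter : ∀ {S} → Character S
  trivialCharacter = record { χ = λ _ → 0 ; χ-ε = refl ; χ-∙ = λ _ _ → refl }

  -- k · c = χ(k · x) is solvable in ℤ/N because k ∣ N and
  -- (N / k) · χ(k · x) = χ(N · x) = 0.
  extensionValue : ∀ {S x k} → RelativeOrder S x k → (φ : Character S) →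
                   ∃ λ c → k * c ≋ χ φ (k · x)
  extensionValue {S} {x} {k} o φ = c , cong (_% N) (trans (*-comm k c) (sym (m∣n⇒n≡quotient*m k∣w)))
    where
    open RelativeOrder o
    open RelativeOrderProperties o
    M = quotient ∣N
    w = χ φ (k · x)
    M*k≡N : M * k ≡ N
    M*k≡N = sym (m∣n⇒n≡quotient*m ∣N)
    M*w≋0 : M * w ≋ 0
    M*w≋0 = begin
      (M * w) % N          ≡⟨ χ-· φ M k·x∈S ⟨
      χ φ (M · k · x) % N  ≡⟨ cong (λ y → χ φ y % N) (×-assocˡ x M k) ⟩
      χ φ ((M * k) · x) % N ≡⟨ cong (λ l → χ φ (l · x) % N) M*k≡N ⟩
      χ φ (N · x) % N      ≡⟨ cong (λ y → χ φ y % N) (N·a≡ε x) ⟩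
      χ φ ε % N            ≡⟨ χ-ε φ ⟩
      0 % N                ∎
      where open ≡-Reasoning
    N∣M*w : N ∣ M * w
    N∣M*w = m%n≡0⇒n∣m (M * w) N (trans M*w≋0 (m<n⇒m%n≡m (>-nonZero⁻¹ N)))
    k∣w : k ∣ w
    k∣w = *-cancelˡ-∣ M {{quotient≢0 ∣N}} (subst (_∣ M * w) (sym M*k≡N) N∣M*w)
    c = quotient k∣w

  module CharacterExtension {S x k} (o : RelativeOrder S x k) (φ : Character S)
                            (c : ℕ) (k*c≋ : k * c ≋ χ φ (k · x)) where
    open RelativeOrder o
    open RelativeOrderProperties o

    χ′ : A → ℕ
    χ′ z with member? (adjoin o) z
    ... | yes (j , _ , _) = χ φ (z - j · x) + j * c
    ... | no  _           = 0

    χ′-digit : ∀ {z j} → j < k → z ∼[ S ] j · x → χ′ z ≋ χ φ (z - j · x) + j * c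
    χ′-digit {z} {j} j<k z∼j·x with member? (adjoin o) z
    ... | no z∉ = ⊥-elim (z∉ (j , j<k , z∼j·x))
    ... | yes (j′ , j′<k , z∼j′·x)
      with ·-injective j′<k j<k (∼-trans S (∼-sym S z∼j′·x) z∼j·x)
    ...   | refl = refl

    carry-value : ∀ {m l} → m ≡ l ⊎ m ≡ k + l → χ φ (m · x - l · x) + l * c ≋ m * c
    carry-value {l = l} (inj₁ refl) = ≋-+ {χ φ (l · x - l · x)} {0} {l * c}
      (trans (cong (λ y → χ φ y % N) (inverseʳ (l · x))) (χ-ε φ)) refl
    carry-value {l = l} (inj₂ refl) = begin
      (χ φ ((k + l) · x - l · x) + l * c) % N  ≡⟨ cong (λ y → (χ φ y + l * c) % N) k+l-l ⟩
      (χ φ (k · x) + l * c) % N                ≡⟨ ≋-+ {χ φ (k · x)} {k * c} (sym k*c≋) refl ⟩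
      (k * c + l * c) % N                      ≡⟨ cong (_% N) (*-distribʳ-+ c k l) ⟨
      ((k + l) * c) % N                        ∎
      where
      open ≡-Reasoning
      k+l-l : (k + l) · x - l · x ≡ k · x
      k+l-l = trans (·-∸ x (m≤n+m l k)) (cong (_· x) (m+n∸n≡m k l))

    χ′-∙ : ∀ {a b} → a ∈ adjoin o → b ∈ adjoin o → χ′ (a ∙ b) ≋ χ′ a + χ′ b
    χ′-∙ {a} {b} (i , i<k , a∼i·x) (j , j<k , b∼j·x) with addDigits i<k j<k
    ... | l , l<k , i+j≡l = begin
      χ′ (a ∙ b) % N                         ≡⟨ χ′-digit l<k (∙-digits {i = i} {j} a∼i·x b∼j·x i+j≡l) ⟩
      (χ φ (a ∙ b - l · x) + l * c) % N      ≡⟨ cong (λ y → (χ φ y + l * c) % N) regroup ⟩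
      (χ φ (a′ ∙ b′ ∙ r) + l * c) % N        ≡⟨ ≋-+ {χ φ (a′ ∙ b′ ∙ r)} (χ-∙∙) refl ⟩
      (χ φ a′ + χ φ b′ + χ φ r + l * c) % N  ≡⟨ cong (_% N) (+-assoc (χ φ a′ + χ φ b′) (χ φ r) (l * c)) ⟩
      (χ φ a′ + χ φ b′ + (χ φ r + l * c)) % N ≡⟨ ≋-+ {χ φ a′ + χ φ b′} refl (carry-value i+j≡l) ⟩
      (χ φ a′ + χ φ b′ + (i + j) * c) % N    ≡⟨ cong (_% N) (rearrange (χ φ a′) (χ φ b′)) ⟩
      (χ φ a′ + i * c + (χ φ b′ + j * c)) % N ≡⟨ ≋-+ {χ′ a} (χ′-digit i<k a∼i·x) (χ′-digit j<k b∼j·x) ⟨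
      (χ′ a + χ′ b) % N                      ∎
      where
      open ≡-Reasoning
      a′ = a - i · x
      b′ = b - j · x
      r  = (i + j) · x - l · x
      regroup : a ∙ b - l · x ≡ a′ ∙ b′ ∙ r
      regroup = sym (begin
        a′ ∙ b′ ∙ r                        ≡⟨ cong (_∙ r) (-‿interchange a b (i · x) (j · x)) ⟨
        (a ∙ b - (i · x ∙ j · x)) ∙ r      ≡⟨ cong (λ y → (a ∙ b - y) ∙ r) (×-homo-+ x i j) ⟨
        (a ∙ b - (i + j) · x) ∙ r          ≡⟨ -‿telescope (a ∙ b) ((i + j) · x) (l · x) ⟩
        a ∙ b - l · x                      ∎)
      χ-∙∙ : χ φ (a′ ∙ b′ ∙ r) ≋ χ φ a′ + χ φ b′ + χ φ r
      χ-∙∙ = trans (χ-∙ φ (∙∈ S a∼i·x b∼j·x) (carry i+j≡l))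
                   (≋-+ {χ φ (a′ ∙ b′)} {χ φ a′ + χ φ b′} (χ-∙ φ a∼i·x b∼j·x) refl)
      rearrange : ∀ u w → u + w + (i + j) * c ≡ u + i * c + (w + j * c)
      rearrange u w = solve 5 (λ u w i j c → u :+ w :+ (i :+ j) :* c := u :+ i :* c :+ (w :+ j :* c)) refl u w i j c

    χ′-agrees : ∀ {z} → z ∈ S → χ′ z ≋ χ φ z
    χ′-agrees {z} z∈S = begin
      χ′ z % N                ≡⟨ χ′-digit positive (subst (_∈ S) (sym (a-ε≡a z)) z∈S) ⟩
      (χ φ (z - ε) + 0) % N   ≡⟨ cong (λ y → (χ φ y + 0) % N) (a-ε≡a z) ⟩
      (χ φ z + 0) % N         ≡⟨ cong (_% N) (+-identityʳ (χ φ z)) ⟩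
      χ φ z % N               ∎
      where open ≡-Reasoning

    χ′-x : 1 < k → χ′ x ≋ c
    χ′-x 1<k = begin
      χ′ x % N                      ≡⟨ χ′-digit 1<k (≡⇒∼ S (sym (×-homo-1 x))) ⟩
      (χ φ (x - 1 · x) + 1 * c) % N ≡⟨ ≋-+ {χ φ (x - 1 · x)} {0} χ[x-1·x]≋0 (cong (_% N) (*-identityˡ c)) ⟩
      c % N                         ∎
      where
      open ≡-Reasoning
      χ[x-1·x]≋0 : χ φ (x - 1 · x) ≋ 0
      χ[x-1·x]≋0 = trans (cong (λ y → χ φ y % N) (trans (cong (x -_) (×-homo-1 x)) (inverseʳ x))) (χ-ε φ)

    extended : Character (adjoin o)
    extended = record { χ = χ′ ; χ-ε = trans (χ′-agrees (ε∈ S)) (χ-ε φ) ; χ-∙ = χ′-∙ }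

  extendCharacter : ∀ {S} → Chain whole S → (φ : Character S) →
                    ∃ λ (ψ : Character whole) → ∀ {z} → z ∈ S → χ ψ z ≋ χ φ z
  extendCharacter (done whole⊆S) φ =
    record { χ = χ φ ; χ-ε = χ-ε φ ; χ-∙ = λ _ _ → χ-∙ φ (whole⊆S tt) (whole⊆S tt) } , λ _ → refl
  extendCharacter (step o _ rest) φ with extensionValue o φ
  ... | c , k*c≋ with extendCharacter rest (CharacterExtension.extended o φ c k*c≋)
  ...   | ψ , ψ-agrees = ψ , λ z∈S →
          trans (ψ-agrees (AdjoinProperties.⊆-adjoin o z∈S)) (CharacterExtension.χ′-agrees o φ c k*c≋ z∈S)

  record CyclicQuotient (d : ℕ) : Set₁ where
    field
      K     : Subgroup
      u     : A
      order : RelativeOrder K u d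
      spans : ∀ z → ∃ λ j → j < d × z ∼[ K ] j · u

  -- With ψ extending g ↦ N / d and c its least positive value (a generator
  -- of its image), K = ψ⁻¹(d c ℤ/N) has cyclic quotient of order d.
  module CyclicQuotientConstruction {g d} (g-order : RelativeOrder trivial g d) (1<d : 1 < d) where
    open RelativeOrderProperties g-order using (∣N)

    n = quotient ∣N

    N≡d*n : N ≡ d * n
    N≡d*n = m∣n⇒n≡m*quotient ∣N

    0<n : 0 < n
    0<n = n≢0⇒n>0 λ n≡0 → ≢-nonZero⁻¹ N (trans N≡d*n (trans (cong (d *_) n≡0) (*-zeroʳ d)))

    n<N : n < N
    n<N = subst (n <_) (trans (*-comm n d) (sym N≡d*n)) (m<m*n n d {{>-nonZero 0<n}} 1<d)

    d*n≋0 : d * n ≋ 0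
    d*n≋0 = trans (cong (_% N) (sym N≡d*n)) (trans (n%n≡0 N) (sym (m<n⇒m%n≡m (>-nonZero⁻¹ N))))

    open CharacterExtension g-order trivialCharacter n d*n≋0 using (extended; χ′-x)

    opaque
      extension : ∃ λ (ψ : Character whole) → ∀ {z} → z ∈ adjoin g-order → χ ψ z ≋ χ extended z
      extension = extendCharacter (chain whole (adjoin g-order)) extended

    ψ = proj₁ extension

    ρ : A → ℕ
    ρ z = χ ψ z % N

    ρ-g : ρ g ≡ n
    ρ-g = trans (proj₂ extension (AdjoinProperties.x∈adjoin g-order))
                (trans (χ′-x 1<d) (m<n⇒m%n≡m n<N))

    Value : ℕ → Set
    Value c = 0 < c × ∃ λ w → ρ w ≡ c

    opaque
      leastValue : ∃ (Least Value)
      leastValue = least (λ c → (0 <? c) ×-dec Finₚ.any? (λ w → ρ w ≟ c)) (0<n , g , ρ-g)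

    c = proj₁ leastValue

    c-value : Value c
    c-value = proj₁ (proj₂ leastValue)

    c-least : ∀ {j} → j < c → ¬ Value j
    c-least = proj₂ (proj₂ leastValue)

    u = proj₁ (proj₂ c-value)

    ρ-u : ρ u ≡ c
    ρ-u = proj₂ (proj₂ c-value)

    instance
      c≢0 : NonZero c
      c≢0 = >-nonZero (proj₁ c-value)

    c<N : c < N
    c<N = ≤-<-trans (≮⇒≥ λ n<c → c-least n<c (0<n , g , ρ-g)) n<N

    χ-·u : ∀ i → χ ψ (i · u) ≋ i * c
    χ-·u i = trans (χ-· ψ i tt) (≋-*ˡ i (trans ρ-u (sym (m<n⇒m%n≡m c<N))))

    χ-split : ∀ z j → χ ψ (z - j · u) + j * c ≋ χ ψ z
    χ-split z j = begin
      (χ ψ (z - j · u) + j * c) % N          ≡⟨ ≋-+ {χ ψ (z - j · u)} refl (χ-·u j) ⟨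
      (χ ψ (z - j · u) + χ ψ (j · u)) % N    ≡⟨ χ-∙ ψ tt tt ⟨
      χ ψ ((z - j · u) ∙ j · u) % N          ≡⟨ cong (λ y → χ ψ y % N) (//-rightDividesˡ (j · u) z) ⟩
      χ ψ z % N                              ∎
      where open ≡-Reasoning

    c∣ρ : ∀ z → c ∣ ρ z
    c∣ρ z with ρ z % c in ρz%c≡r
    ... | zero  = m%n≡0⇒n∣m (ρ z) c ρz%c≡r
    ... | suc r = ⊥-elim (c-least r<c (z<s , w , ρ-w))
      where
      q = ρ z / c
      w = z - q · u
      -- ρ w is ρ z mod c, a positive value smaller than c

      r<c : suc r < c
      r<c = subst (_< c) ρz%c≡r (m%n<n (ρ z) c)
      χ-w : χ ψ w + q * c ≋ suc r + q * c
      χ-w = trans (χ-split z q) (trans (sym (%-≋ (χ ψ z)))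
                  (cong (_% N) (trans (m≡m%n+[m/n]*n (ρ z) c) (cong (_+ q * c) ρz%c≡r))))
      ρ-w : ρ w ≡ suc r
      ρ-w = trans (≋-cancelʳ (q * c) χ-w) (m<n⇒m%n≡m (<-trans r<c c<N))

    d*c∣N : d * c ∣ N
    d*c∣N = subst (d * c ∣_) (sym N≡d*n) (*-monoʳ-∣ d (subst (c ∣_) ρ-g (c∣ρ g)))

    K : Subgroup
    K = record
      { Member  = λ z → d * c ∣ χ ψ z
      ; member? = λ z → d * c ∣? χ ψ z
      ; ε∈      = ∣-resp-≋ d*c∣N (sym (χ-ε ψ)) ((d * c) ∣0)
      ; ∙∈      = λ a∈K b∈K → ∣-resp-≋ d*c∣N (sym (χ-∙ ψ tt tt)) (∣m∣n⇒∣m+n a∈K b∈K)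
      }

    u-order : RelativeOrder K u d
    u-order = record
      { positive = <-trans z<s 1<d
      ; k·x∈S    = ∣-resp-≋ d*c∣N (sym (χ-·u d)) ∣-refl
      ; minimal  = λ {j} 0<j j<d d*c∣ →
          <⇒≢ 0<j (sym (n<m∧m∣n⇒n≡0 j<d (*-cancelʳ-∣ c (∣-resp-≋ d*c∣N (χ-·u j) d*c∣))))
      }

    u-spans : ∀ z → ∃ λ j → j < d × z ∼[ K ] j · u
    u-spans z = j , m%n<n a d , ∣-resp-≋ d*c∣N (sym χ-z-j·u) (*-pres-∣ d∣a∸j ∣-refl)
      where
      instance
        d≢0 : NonZero d
        d≢0 = >-nonZero (<-trans z<s 1<d)
      a = ρ z / c
      j = a % d
      j≤a : j ≤ a
      j≤a = m%n≤m a d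
      χ-z-j·u : χ ψ (z - j · u) ≋ (a ∸ j) * c
      χ-z-j·u = ≋-cancelʳ (j * c) (begin
        (χ ψ (z - j · u) + j * c) % N  ≡⟨ χ-split z j ⟩
        χ ψ z % N                      ≡⟨ %-≋ (χ ψ z) ⟨
        ρ z % N                        ≡⟨ cong (_% N) (m/n*n≡m (c∣ρ z)) ⟨
        (a * c) % N                    ≡⟨ cong (λ l → (l * c) % N) (m∸n+n≡m j≤a) ⟨
        ((a ∸ j + j) * c) % N          ≡⟨ cong (_% N) (*-distribʳ-+ c (a ∸ j) j) ⟩
        ((a ∸ j) * c + j * c) % N      ∎)
        where open ≡-Reasoning
      d∣a∸j : d ∣ a ∸ j
      d∣a∸j = divides (a / d) (trans (cong (_∸ j) (m≡m%n+[m/n]*n a d)) (m+n∸m≡n j (a / d * d)))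

  cyclicQuotient : ∀ {g d} → RelativeOrder trivial g d → 1 < d → CyclicQuotient d
  cyclicQuotient g-order 1<d = record { K = K ; u = u ; order = u-order ; spans = u-spans }
    where open CyclicQuotientConstruction g-order 1<d

  module CyclicQuotientProperties {d} (Q : CyclicQuotient d) where
    open CyclicQuotient Q

    decompose : ∀ z → ∃ λ j → j < d × ∃ λ s → s ∈ K × j · u ∙ s ≡ z
    decompose z = let j , j<d , z-j·u∈K = spans z in
      j , j<d , z - j · u , z-j·u∈K , trans (comm (j · u) (z - j · u)) (//-rightDividesˡ (j · u) z)

    decomposition-unique : ∀ {j j′ s s′} → j < d → j′ < d → s ∈ K → s′ ∈ K →
                           j · u ∙ s ≡ j′ · u ∙ s′ → j ≡ j′ × s ≡ s′
    decomposition-unique {j} {j′} {s} {s′} j<d j′<d s∈K s′∈K j·u∙s≡j′·u∙s′ =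
      j≡j′ , ∙-cancelˡ (j · u) s s′ (trans j·u∙s≡j′·u∙s′ (cong (λ i → i · u ∙ s′) (sym j≡j′)))
      where
      j≡j′ : j ≡ j′
      j≡j′ = RelativeOrderProperties.·-injective order j<d j′<d
        (∼-trans K (∼-sym K (∙-absorbs K s∈K))
          (∼-trans K (≡⇒∼ K j·u∙s≡j′·u∙s′) (∙-absorbs K s′∈K)))

  record HarmoniousOrdering (T S : Subgroup) : Set where
    field
      size           : ℕ
      {{size≢0}}     : NonZero size
      at             : ℕ → A
      at∈T           : ∀ i → at i ∈ T
      at-injective   : ∀ {i j} → i < size → j < size → at i ∼[ S ] at j → i ≡ j
      sums-injective : ∀ {i j} → i < size → j < size →
                       at i ∙ at (suc i % size) ∼[ S ] at j ∙ at (suc j % size) → i ≡ j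
      at-covers      : ∀ {z} → z ∈ T → ∃ λ i → i < size × z ∼[ S ] at i

  module OddOrder (N-odd : ¬ 2 ∣ N) where

    -- With N = 2h + 1, the element (h + 1) · (a ∙ a) = (N + 1) · a is a.
    halve : ∀ {S a} → a ∙ a ∈ S → a ∈ S
    halve {S} {a} a∙a∈S with ¬2∣⇒odd N-odd
    ... | h , N≡1+2h = subst (_∈ S) (h+1·[a∙a]≡a) (·∈ S (suc h) a∙a∈S)
      where
      h+1·[a∙a]≡a : suc h · (a ∙ a) ≡ a
      h+1·[a∙a]≡a = begin
        suc h · (a ∙ a)           ≡⟨ ×-distrib-+ a a (suc h) ⟩
        suc h · a ∙ suc h · a     ≡⟨ ×-homo-+ a (suc h) (suc h) ⟨
        (suc h + suc h) · a       ≡⟨ cong (λ l → suc l · a) (trans (+-suc h h) (cong suc (cong (h +_) (sym (+-identityʳ h))))) ⟩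
        suc (suc (2 * h)) · a     ≡⟨ cong (λ l → suc l · a) N≡1+2h ⟨
        a ∙ N · a                 ≡⟨ cong (a ∙_) (N·a≡ε a) ⟩
        a ∙ ε                     ≡⟨ identityʳ a ⟩
        a                         ∎
        where open ≡-Reasoning

    double-cancel : ∀ {S a b} → a ∙ a ∼[ S ] b ∙ b → a ∼[ S ] b
    double-cancel {S} {a} {b} = halve {S} ∘ subst (_∈ S) (-‿interchange a a b b)

    module _ {T : Subgroup} where

      trivialOrdering : ∀ {S} → T ⊆ S → HarmoniousOrdering T S
      trivialOrdering {S} T⊆S = record
        { size           = 1
        ; at             = λ _ → ε
        ; at∈T           = λ _ → ε∈ T
        ; at-injective   = λ i<1 j<1 _ → trans (n<1⇒n≡0 i<1) (sym (n<1⇒n≡0 j<1))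
        ; sums-injective = λ i<1 j<1 _ → trans (n<1⇒n≡0 i<1) (sym (n<1⇒n≡0 j<1))
        ; at-covers      = λ z∈T → 0 , z<s , ∈⇒∼ε S (T⊆S z∈T)
        }

      -- An ordering of T modulo S + ⟨x⟩ is refined to one modulo S by running
      -- through it once for each digit p < k, translated by p · x. A
      -- consecutive sum then differs from a coarse one by (c + 2p) · x with a
      -- carry c depending only on the coarse position, and doubling is
      -- injective because N is odd.
      module Refine {S x k} (o : RelativeOrder S x k) (x∈T : x ∈ T)
                    (H : HarmoniousOrdering T (adjoin o)) where
        open RelativeOrder o
        open RelativeOrderProperties o
        open AdjoinProperties o
        open HarmoniousOrdering H renaming
          (size to t; at to at′; at∈T to at′∈T; at-injective to at′-injective;
           sums-injective to sums′-injective; at-covers to at′-covers)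

        instance
          k*t≢0 : NonZero (k * t)
          k*t≢0 = m*n≢0 k t

        at : ℕ → A
        at P = at′ (P % t) ∙ (P / t) · x

        at-digits : ∀ j p → at (j + p * t) ≡ at′ (j % t) ∙ (j / t + p) · x
        at-digits j p = cong₂ (λ i l → at′ i ∙ l · x)
          ([m+kn]%n≡m%n j p t)
          (trans (+-distrib-/-∣ʳ j (divides p refl)) (cong (j / t +_) (m*n/n≡m p t)))

        at-small : ∀ {j} p → j < t → at (j + p * t) ≡ at′ j ∙ p · x
        at-small {j} p j<t = trans (at-digits j p) (cong₂ (λ i l → at′ i ∙ (l + p) · x)
                                                         (m<n⇒m%n≡m j<t) (m<n⇒m/n≡0 j<t))

        at-mod : ∀ P → at (P % (k * t)) ∼[ S ] at P
        at-mod P = subst (_∼[ S ] at P)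
          (sym (cong₂ (λ i l → at′ i ∙ l · x) (m∣n⇒o%n%m≡o%m t (k * t) P (n∣m*n k)) (m%[n*o]/o≡m/o%n P k t)))
          (∼-∙ S (∼-refl S) (∼-sym S (%-digit (P / t))))

        ·x∈ : ∀ p → p · x ∈ adjoin o
        ·x∈ p = ·∈ (adjoin o) p x∈adjoin

        drop-digits : ∀ {a b s s′} → s ∈ adjoin o → s′ ∈ adjoin o → a ∙ s ∼[ S ] b ∙ s′ → a ∼[ adjoin o ] b
        drop-digits s∈ s′∈ a∙s∼b∙s′ = ∼-trans (adjoin o) (∼-sym (adjoin o) (∙-absorbs (adjoin o) s∈))
          (∼-trans (adjoin o) (⊆-adjoin a∙s∼b∙s′) (∙-absorbs (adjoin o) s′∈))

        digits-injective : ∀ {P Q} → P % t ≡ Q % t → P / t ≡ Q / t → P ≡ Q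
        digits-injective {P} {Q} P%t≡Q%t P/t≡Q/t = begin
          P                      ≡⟨ m≡m%n+[m/n]*n P t ⟩
          P % t + P / t * t      ≡⟨ cong₂ (λ i l → i + l * t) P%t≡Q%t P/t≡Q/t ⟩
          Q % t + Q / t * t      ≡⟨ m≡m%n+[m/n]*n Q t ⟨
          Q                      ∎
          where open ≡-Reasoning

        at-injective : ∀ {P Q} → P < k * t → Q < k * t → at P ∼[ S ] at Q → P ≡ Q
        at-injective {P} {Q} P<kt Q<kt atP∼atQ = digits-injective P%t≡Q%t
          (·-injective (m<n*o⇒m/o<n P<kt) (m<n*o⇒m/o<n Q<kt)
            (∼-cancelˡ S (subst (λ i → at′ i ∙ (P / t) · x ∼[ S ] at Q) P%t≡Q%t atP∼atQ)))
          where
          P%t≡Q%t : P % t ≡ Q % t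
          P%t≡Q%t = at′-injective (m%n<n P t) (m%n<n Q t) (drop-digits (·x∈ (P / t)) (·x∈ (Q / t)) atP∼atQ)

        pair : ℕ → A
        pair j = at′ j ∙ at′ (suc j % t)

        head : ℕ → A
        head j = pair j ∙ (suc j / t) · x

        head∼pair : ∀ j → head j ∼[ adjoin o ] pair j
        head∼pair j = ∙-absorbs (adjoin o) (·x∈ (suc j / t))

        at-sum : ∀ P → at P ∙ at (suc P) ≡ head (P % t) ∙ ((P / t) · x ∙ (P / t) · x)
        at-sum P = begin
          at P ∙ at (suc P)                                  ≡⟨ cong (λ l → at P ∙ at (suc l)) (m≡m%n+[m/n]*n P t) ⟩
          (at′ j ∙ p · x) ∙ at (suc j + p * t)               ≡⟨ cong ((at′ j ∙ p · x) ∙_) (at-digits (suc j) p) ⟩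
          (at′ j ∙ p · x) ∙ (at′ (suc j % t) ∙ (c + p) · x)  ≡⟨ cong (λ y → (at′ j ∙ p · x) ∙ (at′ (suc j % t) ∙ y)) (×-homo-+ x c p) ⟩
          (at′ j ∙ p · x) ∙ (at′ (suc j % t) ∙ (c · x ∙ p · x)) ≡⟨ interchange (at′ j) (p · x) (at′ (suc j % t)) (c · x ∙ p · x) ⟩
          pair j ∙ (p · x ∙ (c · x ∙ p · x))                 ≡⟨ cong (pair j ∙_) (x∙yz≈y∙xz (p · x) (c · x) (p · x)) ⟩
          pair j ∙ (c · x ∙ (p · x ∙ p · x))                 ≡⟨ assoc (pair j) (c · x) (p · x ∙ p · x) ⟨
          head j ∙ (p · x ∙ p · x)                           ∎
          where
          open ≡-Reasoning
          j = P % t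
          p = P / t
          c = suc j / t

        sums-injective : ∀ {P Q} → P < k * t → Q < k * t →
                         at P ∙ at (suc P % (k * t)) ∼[ S ] at Q ∙ at (suc Q % (k * t)) → P ≡ Q
        sums-injective {P} {Q} P<kt Q<kt sumP∼sumQ = digits-injective P%t≡Q%t
          (·-injective (m<n*o⇒m/o<n P<kt) (m<n*o⇒m/o<n Q<kt) (double-cancel {S} doubled))
          where
          p = P / t
          q = Q / t
          unwrapped : head (P % t) ∙ (p · x ∙ p · x) ∼[ S ] head (Q % t) ∙ (q · x ∙ q · x)
          unwrapped = subst₂ (_∼[ S ]_) (at-sum P) (at-sum Q)
            (∼-trans S (∼-∙ S (∼-refl S) (∼-sym S (at-mod (suc P))))
              (∼-trans S sumP∼sumQ (∼-∙ S (∼-refl S) (at-mod (suc Q)))))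
          P%t≡Q%t : P % t ≡ Q % t
          P%t≡Q%t = sums′-injective (m%n<n P t) (m%n<n Q t)
            (∼-trans (adjoin o) (∼-sym (adjoin o) (head∼pair (P % t)))
              (∼-trans (adjoin o) (drop-digits (∙∈ (adjoin o) (·x∈ p) (·x∈ p)) (∙∈ (adjoin o) (·x∈ q) (·x∈ q)) unwrapped)
                (head∼pair (Q % t))))
          doubled : p · x ∙ p · x ∼[ S ] q · x ∙ q · x
          doubled = ∼-cancelˡ S (subst (λ y → y ∙ (p · x ∙ p · x) ∼[ S ] head (Q % t) ∙ (q · x ∙ q · x))
                                       (cong head P%t≡Q%t) unwrapped)

        at-covers : ∀ {z} → z ∈ T → ∃ λ P → P < k * t × z ∼[ S ] at P
        at-covers {z} z∈T with at′-covers z∈T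
        ... | j , j<t , (p , p<k , z-at′j∼p·x) = j + p * t , j+p*t<k*t ,
          subst₂ (_∼[ S ]_) (//-rightDividesˡ (at′ j) z) (trans (comm (p · x) (at′ j)) (sym (at-small p j<t)))
                 (∼-∙ S z-at′j∼p·x (∼-refl S))
          where
          j+p*t<k*t : j + p * t < k * t
          j+p*t<k*t = <-≤-trans (+-monoˡ-< (p * t) j<t) (*-monoˡ-≤ t p<k)

        refined : HarmoniousOrdering T S
        refined = record
          { size           = k * t
          ; at             = at
          ; at∈T           = λ P → ∙∈ T (at′∈T (P % t)) (·∈ T (P / t) x∈T)
          ; at-injective   = at-injective
          ; sums-injective = sums-injective
          ; at-covers      = at-covers
          }

      harmoniousOrdering : ∀ {S} → Chain T S → HarmoniousOrdering T S
      harmoniousOrdering (done T⊆S)      = trivialOrdering T⊆S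
      harmoniousOrdering (step o x∈T rest) = Refine.refined o x∈T (harmoniousOrdering rest)


toℕ-next : ∀ {n} .{{_ : NonZero n}} (p : Fin n) → toℕ (next p) ≡ suc (toℕ p) % n
toℕ-next {suc n} p = Finₚ.toℕ-fromℕ< _

module OpenWebLabeling
  {N : ℕ} {op : Op₂ (Fin N)} {e : Fin N} {inv : Op₁ (Fin N)}
  (isAbelianGroup : IsAbelianGroup _≡_ op e inv) (N-odd : ¬ 2 ∣ N)
  {k n : ℕ} (0<k : 0 < k) (N≡d*n : N ≡ suc (2 * k) * n)
  (Q : FiniteAbelianGroup.CyclicQuotient isAbelianGroup (suc (2 * k))) where

  open FiniteAbelianGroup isAbelianGroup
  open OddOrder N-odd

  d = suc (2 * k)

  open CyclicQuotient Q
  open CyclicQuotientProperties Q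

  opaque
    ordering : HarmoniousOrdering K trivial
    ordering = harmoniousOrdering (chain K trivial)

  open HarmoniousOrdering ordering

  size≡n : size ≡ n
  size≡n = *-cancelˡ-≡ size n d (trans (product-count (λ j i → j · u ∙ at i) unique onto) N≡d*n)
    where
    unique : ∀ {j i j′ i′} → j < d → i < size → j′ < d → i′ < size →
             j · u ∙ at i ≡ j′ · u ∙ at i′ → j ≡ j′ × i ≡ i′
    unique j<d i<size j′<d i′<size eq =
      let j≡j′ , at-i≡at-i′ = decomposition-unique j<d j′<d (at∈T _) (at∈T _) eq
      in j≡j′ , at-injective i<size i′<size (≡⇒∼ trivial at-i≡at-i′)
    onto : ∀ z → ∃ λ j → ∃ λ i → j < d × i < size × j · u ∙ at i ≡ z
    onto z with decompose z
    ... | j , j<d , s , s∈K , j·u∙s≡z with at-covers s∈K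
    ...   | i , i<size , s∼at-i = j , i , j<d , i<size , trans (cong (j · u ∙_) (sym (∼trivial⇒≡ s∼at-i))) j·u∙s≡z

  instance
    size≢0′ : NonZero size
    size≢0′ = size≢0
    n≢0 : NonZero n
    n≢0 = subst NonZero size≡n size≢0

  b : Fin n → A
  b p = at (toℕ p)

  b∈K : ∀ p → b p ∈ K
  b∈K p = at∈T (toℕ p)

  <n⇒<size : ∀ {i} → i < n → i < size
  <n⇒<size {i} = subst (i <_) (sym size≡n)

  b-injective : ∀ {p q} → b p ≡ b q → p ≡ q
  b-injective {p} {q} bp≡bq = Finₚ.toℕ-injective
    (at-injective (<n⇒<size (Finₚ.toℕ<n p)) (<n⇒<size (Finₚ.toℕ<n q)) (≡⇒∼ trivial bp≡bq))

  b-next : ∀ p → b (next p) ≡ at (suc (toℕ p) % size)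
  b-next p = cong at (trans (toℕ-next p) (%-congʳ (sym size≡n)))

  index : ∀ {s} → s ∈ K → Fin n
  index s∈K = let i , i<size , _ = at-covers s∈K in fromℕ< (subst (i <_) size≡n i<size)

  b-index : ∀ {s} (s∈K : s ∈ K) → b (index s∈K) ≡ s
  b-index s∈K = let i , i<size , s∼at-i = at-covers s∈K in
    trans (cong at (Finₚ.toℕ-fromℕ< _)) (sym (∼trivial⇒≡ s∼at-i))

  b-sums-injective : ∀ {p q} → b p ∙ b (next p) ≡ b q ∙ b (next q) → p ≡ q
  b-sums-injective {p} {q} eq = Finₚ.toℕ-injective
    (sums-injective (<n⇒<size (Finₚ.toℕ<n p)) (<n⇒<size (Finₚ.toℕ<n q))
      (≡⇒∼ trivial (subst₂ (λ x y → b p ∙ x ≡ b q ∙ y) (b-next p) (b-next q) eq)))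

  b-doubles-injective : ∀ {p q} → b p ∙ b p ≡ b q ∙ b q → p ≡ q
  b-doubles-injective = b-injective ∘ ∼trivial⇒≡ ∘ double-cancel {trivial} ∘ ≡⇒∼ trivial

  σ : Fin n → Fin n
  σ p = index (∙∈ K (b∈K p) (b∈K (next p)))

  b-σ : ∀ p → b (σ p) ≡ b p ∙ b (next p)
  b-σ p = b-index (∙∈ K (b∈K p) (b∈K (next p)))

  σ-injective : ∀ {p q} → σ p ≡ σ q → p ≡ q
  σ-injective {p} {q} σp≡σq = b-sums-injective (trans (sym (b-σ p)) (trans (cong b σp≡σq) (b-σ q)))

  δ : Fin n → Fin n
  δ p = index (∙∈ K (b∈K p) (b∈K p))

  b-δ : ∀ p → b (δ p) ≡ b p ∙ b p
  b-δ p = b-index (∙∈ K (b∈K p) (b∈K p))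

  δ-injective : ∀ {p q} → δ p ≡ δ q → p ≡ q
  δ-injective {p} {q} δp≡δq = b-doubles-injective (trans (sym (b-δ p)) (trans (cong b δp≡δq) (b-δ q)))

  F : OWVertex (suc k) n → A
  F hub     = (2 * k) · u
  F (v i p) = toℕ i · u ∙ b p

  digit : OWEdge (suc k) n → ℕ
  digit (spoke _)  = 2 * k
  digit (cyc i _)  = 2 * toℕ i
  digit (rung i _) = suc (2 * toℕ i)

  residue : OWEdge (suc k) n → A
  residue (spoke p)  = b p
  residue (cyc _ p)  = b p ∙ b (next p)
  residue (rung _ p) = b p ∙ b p

  digit<d : ∀ ed → digit ed < d
  digit<d (spoke _)  = n<1+n (2 * k)
  digit<d (cyc i _)  = m<n⇒m<1+n (*-monoʳ-< 2 (Finₚ.toℕ<n i))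
  digit<d (rung i _) = s≤s (*-monoʳ-< 2 (Finₚ.toℕ<n i))

  residue∈K : ∀ ed → residue ed ∈ K
  residue∈K (spoke p)  = b∈K p
  residue∈K (cyc _ p)  = ∙∈ K (b∈K p) (b∈K (next p))
  residue∈K (rung _ p) = ∙∈ K (b∈K p) (b∈K p)

  edgeLabel-digits : ∀ ed → edgeLabel abelianGroup F ed ≡ digit ed · u ∙ residue ed
  edgeLabel-digits (spoke p)  = cong ((2 * k) · u ∙_) (identityˡ (b p))
  edgeLabel-digits (cyc i p)  = begin
    (toℕ (inject₁ i) · u ∙ b p) ∙ (toℕ (inject₁ i) · u ∙ b (next p))
      ≡⟨ cong (λ l → (l · u ∙ b p) ∙ (l · u ∙ b (next p))) (Finₚ.toℕ-inject₁ i) ⟩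
    (toℕ i · u ∙ b p) ∙ (toℕ i · u ∙ b (next p))
      ≡⟨ interchange (toℕ i · u) (b p) (toℕ i · u) (b (next p)) ⟩
    (toℕ i · u ∙ toℕ i · u) ∙ (b p ∙ b (next p))
      ≡⟨ cong (_∙ (b p ∙ b (next p))) (trans (cong (λ l → (toℕ i + l) · u) (+-identityʳ (toℕ i))) (×-homo-+ u (toℕ i) (toℕ i))) ⟨
    (2 * toℕ i) · u ∙ (b p ∙ b (next p))
      ∎
    where open ≡-Reasoning
  edgeLabel-digits (rung i p) = begin
    (toℕ (inject₁ i) · u ∙ b p) ∙ (suc (toℕ i) · u ∙ b p)
      ≡⟨ cong (λ l → (l · u ∙ b p) ∙ (suc (toℕ i) · u ∙ b p)) (Finₚ.toℕ-inject₁ i) ⟩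
    (toℕ i · u ∙ b p) ∙ (suc (toℕ i) · u ∙ b p)
      ≡⟨ interchange (toℕ i · u) (b p) (suc (toℕ i) · u) (b p) ⟩
    (toℕ i · u ∙ suc (toℕ i) · u) ∙ (b p ∙ b p)
      ≡⟨ cong (_∙ (b p ∙ b p)) (×-homo-+ u (toℕ i) (suc (toℕ i))) ⟨
    (toℕ i + suc (toℕ i)) · u ∙ (b p ∙ b p)
      ≡⟨ cong (λ l → l · u ∙ (b p ∙ b p)) (trans (+-suc (toℕ i) (toℕ i)) (cong (λ l → suc (toℕ i + l)) (sym (+-identityʳ (toℕ i))))) ⟩
    suc (2 * toℕ i) · u ∙ (b p ∙ b p)
      ∎
    where open ≡-Reasoning

  digit-residue-injective : ∀ ed ed′ → digit ed ≡ digit ed′ → residue ed ≡ residue ed′ → ed ≡ ed′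
  digit-residue-injective (spoke p)  (spoke q)  _ r = cong spoke (b-injective r)
  digit-residue-injective (spoke p)  (cyc i q)  d _ = ⊥-elim (<⇒≢ (*-monoʳ-< 2 (Finₚ.toℕ<n i)) (sym d))
  digit-residue-injective (spoke p)  (rung i q) d _ = ⊥-elim (even≢odd k (toℕ i) d)
  digit-residue-injective (cyc i p)  (spoke q)  d _ = ⊥-elim (<⇒≢ (*-monoʳ-< 2 (Finₚ.toℕ<n i)) d)
  digit-residue-injective (cyc i p)  (cyc j q)  d r =
    cong₂ cyc (Finₚ.toℕ-injective (*-cancelˡ-≡ (toℕ i) (toℕ j) 2 d)) (b-sums-injective r)
  digit-residue-injective (cyc i p)  (rung j q) d _ = ⊥-elim (even≢odd (toℕ i) (toℕ j) d)
  digit-residue-injective (rung i p) (spoke q)  d _ = ⊥-elim (even≢odd k (toℕ i) (sym d))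
  digit-residue-injective (rung i p) (cyc j q)  d _ = ⊥-elim (even≢odd (toℕ j) (toℕ i) (sym d))
  digit-residue-injective (rung i p) (rung j q) d r =
    cong₂ rung (Finₚ.toℕ-injective (*-cancelˡ-≡ (toℕ i) (toℕ j) 2 (suc-injective d))) (b-doubles-injective r)

  edgeLabel-injective : ∀ ed ed′ → edgeLabel abelianGroup F ed ≡ edgeLabel abelianGroup F ed′ → ed ≡ ed′
  edgeLabel-injective ed ed′ eq = uncurry (digit-residue-injective ed ed′)
    (decomposition-unique (digit<d ed) (digit<d ed′) (residue∈K ed) (residue∈K ed′)
      (trans (sym (edgeLabel-digits ed)) (trans eq (edgeLabel-digits ed′))))

  edge-with : ∀ {j s} → j < d → s ∈ K → ∃ λ ed → digit ed ≡ j × residue ed ≡ s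
  edge-with {j} {s} j<d s∈K with evenOrOdd j
  ... | i , inj₁ refl with i <? k
  ...   | yes i<k = cyc (fromℕ< i<k) p , cong (2 *_) (Finₚ.toℕ-fromℕ< i<k) ,
                    trans (sym (b-σ p)) (trans (cong b σp≡) (b-index s∈K))
    where
    p = proj₁ (injective⇒surjective σ-injective (index s∈K))
    σp≡ = proj₂ (injective⇒surjective σ-injective (index s∈K))
  ...   | no  i≮k = spoke (index s∈K) , cong (2 *_) (≤-antisym (≮⇒≥ i≮k) i≤k) , b-index s∈K
    where
    i≤k : i ≤ k
    i≤k = *-cancelˡ-≤ 2 (s≤s⁻¹ j<d)
  edge-with {j} {s} j<d s∈K | i , inj₂ refl = rung (fromℕ< i<k) p , cong (suc ∘ (2 *_)) (Finₚ.toℕ-fromℕ< i<k) ,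
                    trans (sym (b-δ p)) (trans (cong b δp≡) (b-index s∈K))
    where
    i<k : i < k
    i<k = *-cancelˡ-< 2 i k (s≤s⁻¹ j<d)
    p = proj₁ (injective⇒surjective δ-injective (index s∈K))
    δp≡ = proj₂ (injective⇒surjective δ-injective (index s∈K))

  edgeLabel-surjective : ∀ z → ∃ λ ed → edgeLabel abelianGroup F ed ≡ z
  edgeLabel-surjective z with decompose z
  ... | j , j<d , s , s∈K , j·u∙s≡z with edge-with j<d s∈K
  ...   | ed , digit≡j , residue≡s =
          ed , trans (edgeLabel-digits ed) (trans (cong₂ (λ l r → l · u ∙ r) digit≡j residue≡s) j·u∙s≡z)

  vertex-digit<d : ∀ (i : Fin (suc k)) → toℕ i < d
  vertex-digit<d i = s≤s (≤-trans (Finₚ.toℕ≤pred[n] i) (m≤m+n k (k + 0)))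

  hub≢v : ∀ i p → F hub ≢ F (v i p)
  hub≢v i p eq = <⇒≢ (≤-<-trans (Finₚ.toℕ≤pred[n] i) k<2k) (sym (proj₁ (decomposition-unique
    (n<1+n (2 * k)) (vertex-digit<d i) (ε∈ K) (b∈K p) (trans (identityʳ ((2 * k) · u)) eq))))
    where
    k<2k : k < 2 * k
    k<2k = subst (k <_) (cong (k +_) (sym (+-identityʳ k))) (m<m+n k 0<k)

  F-injective : ∀ x y → F x ≡ F y → x ≡ y
  F-injective hub     hub     _ = refl
  F-injective hub     (v i p) eq = ⊥-elim (hub≢v i p eq)
  F-injective (v i p) hub     eq = ⊥-elim (hub≢v i p (sym eq))
  F-injective (v i p) (v j q) eq =
    let i≡j , bp≡bq = decomposition-unique (vertex-digit<d i) (vertex-digit<d j) (b∈K p) (b∈K q) eq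
    in cong₂ v (Finₚ.toℕ-injective i≡j) (b-injective bp≡bq)

  F-harmonious : IsHarmoniousOW abelianGroup (suc k) n F
  F-harmonious = F-injective , edgeLabel-injective , edgeLabel-surjective


module Transport {c ℓ} (G : AbelianGroup c ℓ) {N : ℕ} (G≅Fin : HasOrder G N) where
  open AbelianGroup G using (Carrier; _≈_; _∙_; ε; _⁻¹; ∙-cong; ∙-congˡ; ∙-congʳ)
  open AbelianGroup G using () renaming
    (setoid to ≈-setoid; refl to ≈-refl; sym to ≈-sym; trans to ≈-trans; reflexive to ≈-reflexive;
     assoc to ≈-assoc; comm to ≈-comm; identityˡ to ≈-identityˡ; identityʳ to ≈-identityʳ;
     inverseˡ to ≈-inverseˡ; inverseʳ to ≈-inverseʳ)
  open import Relation.Binary.Reasoning.Setoid ≈-setoid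

  e : Fin N → Carrier
  e = proj₁ G≅Fin

  e-injective : ∀ a b → e a ≈ e b → a ≡ b
  e-injective = proj₁ (proj₂ G≅Fin)

  index : Carrier → Fin N
  index z = proj₁ (proj₂ (proj₂ G≅Fin) z)

  e-index : ∀ z → e (index z) ≈ z
  e-index z = proj₂ (proj₂ (proj₂ G≅Fin) z)

  index-cong : ∀ {x y} → x ≈ y → index x ≡ index y
  index-cong {x} {y} x≈y = e-injective _ _ (≈-trans (e-index x) (≈-trans x≈y (≈-sym (e-index y))))

  _⊕_ : Fin N → Fin N → Fin N
  a ⊕ b = index (e a ∙ e b)

  𝟘 : Fin N
  𝟘 = index ε

  ⊝_ : Fin N → Fin N
  ⊝ a = index (e a ⁻¹)

  isAbelianGroup : IsAbelianGroup _≡_ _⊕_ 𝟘 ⊝_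
  isAbelianGroup = record
    { isGroup = record
      { isMonoid = record
        { isSemigroup = record
          { isMagma = record { isEquivalence = isEquivalence ; ∙-cong = cong₂ _⊕_ }
          ; assoc   = λ a b c → index-cong (begin
              e (a ⊕ b) ∙ e c     ≈⟨ ∙-congʳ (e-index _) ⟩
              (e a ∙ e b) ∙ e c   ≈⟨ ≈-assoc _ _ _ ⟩
              e a ∙ (e b ∙ e c)   ≈⟨ ∙-congˡ (e-index _) ⟨
              e a ∙ e (b ⊕ c)     ∎)
          }
        ; identity = (λ a → e-injective _ _ (≈-trans (e-index _) (≈-trans (∙-congʳ (e-index ε)) (≈-identityˡ _))))
                   , (λ a → e-injective _ _ (≈-trans (e-index _) (≈-trans (∙-congˡ (e-index ε)) (≈-identityʳ _))))
        }
      ; inverse = (λ a → index-cong (≈-trans (∙-congʳ (e-index _)) (≈-inverseˡ _)))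
                , (λ a → index-cong (≈-trans (∙-congˡ (e-index _)) (≈-inverseʳ _)))
      ; ⁻¹-cong = cong ⊝_
      }
    ; comm = λ a b → index-cong (≈-comm _ _)
    }

  open FiniteAbelianGroup isAbelianGroup using (abelianGroup; trivial; RelativeOrder; _·_)

  e-· : ∀ j a → e (j · a) ≈ Defs._·_ G j (e a)
  e-· zero    a = e-index ε
  e-· (suc j) a = ≈-trans (e-index _) (∙-congˡ (e-· j a))

  ·ᴳ-cong : ∀ j {x y} → x ≈ y → Defs._·_ G j x ≈ Defs._·_ G j y
  ·ᴳ-cong zero    _   = ≈-refl
  ·ᴳ-cong (suc j) x≈y = ∙-cong x≈y (·ᴳ-cong j x≈y)

  relativeOrder : ∀ {g d} → ElementOrder G g d → RelativeOrder trivial (index g) d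
  relativeOrder {g} {d} (d≢0 , d·g≈ε , below) = record
    { positive = >-nonZero⁻¹ d {{d≢0}}
    ; k·x∈S    = e-injective _ _ (≈-trans (e-·g d) (≈-trans d·g≈ε (≈-sym (e-index ε))))
    ; minimal  = λ {j} 0<j j<d j·g≡𝟘 → below j 0<j j<d
                   (≈-trans (≈-sym (e-·g j)) (≈-trans (≈-reflexive (cong e j·g≡𝟘)) (e-index ε)))
    }
    where
    e-·g : ∀ j → e (j · index g) ≈ Defs._·_ G j g
    e-·g j = ≈-trans (e-· j (index g)) (·ᴳ-cong j (e-index g))

  transport-harmonious : ∀ {m n F} → IsHarmoniousOW abelianGroup m n F → IsHarmoniousOW G m n (e ∘ F)
  transport-harmonious {F = F} (F-injective , W-injective , W-surjective) =
      (λ x y ex≈ey → F-injective x y (e-injective _ _ ex≈ey))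
    , (λ ed ed′ eq → W-injective ed ed′ (e-injective _ _ (≈-trans (≈-sym (e-edgeLabel ed)) (≈-trans eq (e-edgeLabel ed′)))))
    , λ z → let ed , W≡ = W-surjective (index z) in
            ed , ≈-trans (e-edgeLabel ed) (≈-trans (≈-reflexive (cong e W≡)) (e-index z))
    where
    e-edgeLabel : ∀ ed → edgeLabel G (e ∘ F) ed ≈ e (edgeLabel abelianGroup F ed)
    e-edgeLabel ed with ends ed
    ... | x , y = ≈-sym (e-index _)

corollary8p11 : {c ℓ : Level} (m n : ℕ) → 3 ≤ n → ¬ (2 ∣ n) → 2 ≤ m →
    (G : AbelianGroup c ℓ) →
    HasOrder G ((2 * m ∸ 1) * n) →
    HasCyclicSubgroupOfOrder G (2 * m ∸ 1) →
    ∃ λ (f : OWVertex m n → AbelianGroup.Carrier G) → IsHarmoniousOW G m n f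
corollary8p11 (suc (suc k′)) n _ ¬2∣n (s≤s (s≤s _)) G G≅Fin (g , g-order) =
  e ∘ F , transport-harmonious F-harmonious
  where
  k = suc k′
  open Transport G G≅Fin
  d≡1+2k : 2 * suc k ∸ 1 ≡ suc (2 * k)
  d≡1+2k = +-suc k (k + 0)
  N-odd : ¬ 2 ∣ (2 * suc k ∸ 1) * n
  N-odd = subst (λ d → ¬ 2 ∣ d * n) (sym d≡1+2k) (¬2∣* (¬2∣1+2* k) ¬2∣n)
  open FiniteAbelianGroup isAbelianGroup using (RelativeOrder; trivial; cyclicQuotient)
  Q = cyclicQuotient (subst (RelativeOrder trivial (index g)) d≡1+2k (relativeOrder g-order)) (s≤s (s≤s z≤n))
  open OpenWebLabeling isAbelianGroup N-odd {k} {n} z<s (cong (_* n) d≡1+2k) Q using (F; F-harmonious)
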